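{- Let $a\le -1$ be an integer. Define $b_{\mathcal{G}}(n)$, $n\ge0$, by $b_{\mathcal{G}}(0)=1$, $b_{\mathcal{G}}(1)=-1$, $b_{\mathcal{G}}(2)=a$ and, for $n\ge3$, $$b_{\mathcal{G}}(n)=-\frac12\left(\sum_{k=0}^{n-2}b_{\mathcal{G}}(k)\binom{n}{k+1}+\sum_{k=0}^{n-1}b_{\mathcal{G}}(k)\binom{n+1}{k+1}\right).$$ For integers $0\le j\le d$ set $s_{\mathcal{G}}(j,d)=\sum_{k=j}^d\frac{1}{k+1}\binom{d-j}{d-k}b_{\mathcal{G}}(k)$. Then for all $d\ge0$ and $0\le j\le d$, $s_{\mathcal{G}}(j,d)=(-1)^ds_{\mathcal{G}}(d-j,d)$. -}

module Defs where

open import Data.Nat as ℕ using (ℕ; zero; suc; _∸_; _<ᵇ_)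
open import Data.Nat.Combinatorics using (_C_)
open import Data.Integer as ℤ using (ℤ; +_)
open import Data.Rational using (ℚ; _/_; _+_; _*_; -_; ½; 0ℚ; 1ℚ)
open import Data.List using (List; map; upTo; foldr)
open import Data.Bool using (if_then_else_)

sumℚ : List ℚ → ℚ
sumℚ = foldr _+_ 0ℚ

-- Σ_{k=lo}^{hi} f k  (empty when hi < lo)
sumFromTo : ℕ → ℕ → (ℕ → ℚ) → ℚ
sumFromTo lo hi f = sumℚ (map (λ i → f (lo ℕ.+ i)) (upTo (suc hi ∸ lo)))

ℕ→ℚ : ℕ → ℚ
ℕ→ℚ n = (+ n) / 1

signℚ : ℕ → ℚ
signℚ zero    = 1ℚ
signℚ (suc d) = - signℚ d

-- the value b(n) computed from values f k = b(k) for k < n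
next : ℤ → ℕ → (ℕ → ℚ) → ℚ
next a 0 f = 1ℚ
next a 1 f = - 1ℚ
next a 2 f = a / 1
next a n@(suc (suc (suc m))) f =
  - (½ * ( sumFromTo 0 (n ∸ 2) (λ k → f k * ℕ→ℚ (n C suc k))
         + sumFromTo 0 (n ∸ 1) (λ k → f k * ℕ→ℚ (suc n C suc k))))

-- approx a m k = b(k) for all k < m
approx : ℤ → ℕ → ℕ → ℚ
approx a zero    k = 0ℚ
approx a (suc m) k = if k <ᵇ m then approx a m k else next a m (approx a m)

bG : ℤ → ℕ → ℚ
bG a n = approx a (suc n) n

sG : ℤ → ℕ → ℕ → ℚ
sG a j d = sumFromTo j d (λ k → ((+ 1) / suc k) * ℕ→ℚ ((d ∸ j) C (d ∸ k)) * bG a k)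

module Submission where

-- With c(k) = b_G(k)/(k+1) one has s_G(j, j+m) = S(j,m) := Σᵢ (m choose i) c(j+i), and S obeys
-- Pascal's rule S(j,m+1) = S(j+1,m) + S(j,m); hence so does the defect
-- D(j,m) = S(j,m) − (−1)^(j+m) S(m,j).  D vanishes on each level j + m = n, by induction on n:
-- if it vanishes on level n, Pascal's rule makes D constant on level n+1, equal to D(n+1,0).
-- For n+1 even, D(0,n+1) = −D(n+1,0) forces this value to be 0.  For n+1 odd, D(n,0) = 0 says
-- Σ_{i<n} (n choose i) c(i) = 0, and with this the recurrence defining b_G(n+1) gives D(n+1,0) = 0.

open import Data.Bool using (true; false; if_then_else_)
open import Data.Integer as ℤ using (ℤ; +_; -[1+_]) renaming (_≤_ to _≤ℤ_)
import Data.Integer.Properties as ℤ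
open import Data.List using (map; applyUpTo)
open import Data.Nat as ℕ using (ℕ; zero; suc; _≤_; _<_; _∸_; _<ᵇ_; z<s; s<s)
open import Data.Nat.Properties
  using (+-identityʳ; +-suc; +-comm; *-identityˡ; *-identityʳ; *-zeroʳ; *-distribˡ-+; suc-injective; n<1+n;
         n≤1+n; ≤-refl; m<1+n⇒m<n∨m≡n; <⇒<ᵇ; <-≤-trans; m+n∸m≡n; m+[n∸m]≡n;
         [m+n]∸[m+o]≡n∸o; ≤-pred)
open import Data.Nat.Combinatorics
  using (_C_; nCk+nC[k+1]≡[n+1]C[k+1]; nC1≡n; nCn≡1; nCk≡nC[n∸k]; k>n⇒nCk≡0)
import Data.Nat.Solver as ℕ-Solver
open import Data.Rational using (ℚ; _/_; _+_; _*_; -_; _-_; ½; 0ℚ; 1ℚ; toℚᵘ)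
import Data.Rational.Properties as ℚ
import Data.Rational.Solver as ℚ-Solver
import Data.Rational.Unnormalised as ℚᵘ
import Data.Rational.Unnormalised.Properties as ℚᵘ
open import Data.Sum using (_⊎_; inj₁; inj₂)
open import Relation.Binary.PropositionalEquality

open import Defs

toℚᵘ-ℕ→ℚ : ∀ n → toℚᵘ (ℕ→ℚ n) ℚᵘ.≃ ℚᵘ.mkℚᵘ (+ n) 0
toℚᵘ-ℕ→ℚ n = ℚ.toℚᵘ-fromℚᵘ (ℚᵘ.mkℚᵘ (+ n) 0)

ℕ→ℚ-+ : ∀ m n → ℕ→ℚ (m ℕ.+ n) ≡ ℕ→ℚ m + ℕ→ℚ n
ℕ→ℚ-+ m n = ℚ.toℚᵘ-injective (begin
  toℚᵘ (ℕ→ℚ (m ℕ.+ n))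
    ≈⟨ toℚᵘ-ℕ→ℚ (m ℕ.+ n) ⟩
  ℚᵘ.mkℚᵘ (+ (m ℕ.+ n)) 0
    ≈⟨ ℚᵘ.*≡* (cong (ℤ._* + 1) homo) ⟩
  ℚᵘ.mkℚᵘ (+ m) 0 ℚᵘ.+ ℚᵘ.mkℚᵘ (+ n) 0
    ≈⟨ ℚᵘ.+-cong (toℚᵘ-ℕ→ℚ m) (toℚᵘ-ℕ→ℚ n) ⟨
  toℚᵘ (ℕ→ℚ m) ℚᵘ.+ toℚᵘ (ℕ→ℚ n)
    ≈⟨ ℚ.toℚᵘ-homo-+ (ℕ→ℚ m) (ℕ→ℚ n) ⟨
  toℚᵘ (ℕ→ℚ m + ℕ→ℚ n)
    ∎)
  where
  open ℚᵘ.≃-Reasoning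
  homo : + (m ℕ.+ n) ≡ + m ℤ.* + 1 ℤ.+ + n ℤ.* + 1
  homo = trans (ℤ.pos-+ m n) (sym (cong₂ ℤ._+_ (ℤ.*-identityʳ (+ m)) (ℤ.*-identityʳ (+ n))))

ℕ→ℚ-* : ∀ m n → ℕ→ℚ (m ℕ.* n) ≡ ℕ→ℚ m * ℕ→ℚ n
ℕ→ℚ-* m n = ℚ.toℚᵘ-injective (begin
  toℚᵘ (ℕ→ℚ (m ℕ.* n))
    ≈⟨ toℚᵘ-ℕ→ℚ (m ℕ.* n) ⟩
  ℚᵘ.mkℚᵘ (+ (m ℕ.* n)) 0
    ≈⟨ ℚᵘ.*≡* (cong (ℤ._* + 1) (ℤ.pos-* m n)) ⟩
  ℚᵘ.mkℚᵘ (+ m) 0 ℚᵘ.* ℚᵘ.mkℚᵘ (+ n) 0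
    ≈⟨ ℚᵘ.*-cong (toℚᵘ-ℕ→ℚ m) (toℚᵘ-ℕ→ℚ n) ⟨
  toℚᵘ (ℕ→ℚ m) ℚᵘ.* toℚᵘ (ℕ→ℚ n)
    ≈⟨ ℚ.toℚᵘ-homo-* (ℕ→ℚ m) (ℕ→ℚ n) ⟨
  toℚᵘ (ℕ→ℚ m * ℕ→ℚ n)
    ∎)
  where open ℚᵘ.≃-Reasoning

ℕ→ℚ-suc*1/suc : ∀ k → ℕ→ℚ (suc k) * ((+ 1) / suc k) ≡ 1ℚ
ℕ→ℚ-suc*1/suc k = ℚ.toℚᵘ-injective (begin
  toℚᵘ (ℕ→ℚ (suc k) * ((+ 1) / suc k))
    ≈⟨ ℚ.toℚᵘ-homo-* (ℕ→ℚ (suc k)) ((+ 1) / suc k) ⟩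
  toℚᵘ (ℕ→ℚ (suc k)) ℚᵘ.* toℚᵘ ((+ 1) / suc k)
    ≈⟨ ℚᵘ.*-cong (toℚᵘ-ℕ→ℚ (suc k)) (ℚ.toℚᵘ-fromℚᵘ (ℚᵘ.mkℚᵘ (+ 1) k)) ⟩
  ℚᵘ.mkℚᵘ (+ suc k) 0 ℚᵘ.* ℚᵘ.mkℚᵘ (+ 1) k
    ≈⟨ ℚᵘ.*≡* cross ⟩
  toℚᵘ 1ℚ
    ∎)
  where
  open ℚᵘ.≃-Reasoning
  cross : (+ suc k ℤ.* + 1) ℤ.* + 1 ≡ + 1 ℤ.* + (1 ℕ.* suc k)
  cross = trans (ℤ.*-identityʳ _) (trans (ℤ.*-identityʳ _)
            (sym (trans (ℤ.*-identityˡ _) (cong +_ (*-identityˡ (suc k))))))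

[1+k]*[1+n]C[1+k]≡[1+n]*nCk : ∀ n k → suc k ℕ.* (suc n C suc k) ≡ suc n ℕ.* (n C k)
[1+k]*[1+n]C[1+k]≡[1+n]*nCk zero    zero    = refl
[1+k]*[1+n]C[1+k]≡[1+n]*nCk zero    (suc k) =
  trans (cong (suc (suc k) ℕ.*_) (k>n⇒nCk≡0 {1} {suc (suc k)} (s<s z<s))) (*-zeroʳ (suc (suc k)))
[1+k]*[1+n]C[1+k]≡[1+n]*nCk (suc n) zero    =
  trans (*-identityˡ (suc (suc n) C 1)) (trans (nC1≡n (suc (suc n))) (sym (*-identityʳ (suc (suc n)))))
[1+k]*[1+n]C[1+k]≡[1+n]*nCk (suc n) (suc k) = begin
  suc (suc k) ℕ.* (suc (suc n) C suc (suc k))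
    ≡⟨ cong (suc (suc k) ℕ.*_) (pascal (suc n) (suc k)) ⟩
  suc (suc k) ℕ.* (x ℕ.+ y)
    ≡⟨ solve 3 (λ k x y → (con 2 :+ k) :* (x :+ y)
        := ((con 1 :+ k) :* x :+ (con 2 :+ k) :* y) :+ x) refl k x y ⟩
  (suc k ℕ.* x ℕ.+ suc (suc k) ℕ.* y) ℕ.+ x
    ≡⟨ cong₂ (λ u v → (u ℕ.+ v) ℕ.+ x)
        ([1+k]*[1+n]C[1+k]≡[1+n]*nCk n k)
        ([1+k]*[1+n]C[1+k]≡[1+n]*nCk n (suc k)) ⟩
  (suc n ℕ.* (n C k) ℕ.+ suc n ℕ.* (n C suc k)) ℕ.+ x
    ≡⟨ cong (ℕ._+ x) (sym (*-distribˡ-+ (suc n) (n C k) (n C suc k))) ⟩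
  suc n ℕ.* (n C k ℕ.+ n C suc k) ℕ.+ x
    ≡⟨ cong (λ u → suc n ℕ.* u ℕ.+ x) (sym (pascal n k)) ⟩
  suc n ℕ.* x ℕ.+ x
    ≡⟨ +-comm (suc n ℕ.* x) x ⟩
  suc (suc n) ℕ.* x
    ∎
  where
  open ≡-Reasoning
  open ℕ-Solver.+-*-Solver
  pascal : ∀ n k → suc n C suc k ≡ n C k ℕ.+ n C suc k
  pascal n k = sym (nCk+nC[k+1]≡[n+1]C[k+1] n k)
  x = suc n C suc k
  y = suc n C suc (suc k)

n<ᵇn≡false : ∀ n → (n <ᵇ n) ≡ false
n<ᵇn≡false zero    = refl
n<ᵇn≡false (suc n) = n<ᵇn≡false n

open ℚ-Solver.+-*-Solver

ℕ→ℚ-suc*x≡0⇒x≡0 : ∀ k x → ℕ→ℚ (suc k) * x ≡ 0ℚ → x ≡ 0ℚ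
ℕ→ℚ-suc*x≡0⇒x≡0 k x kx≡0 = begin
  x
    ≡⟨ sym (ℚ.*-identityˡ x) ⟩
  1ℚ * x
    ≡⟨ cong (_* x) (sym (ℕ→ℚ-suc*1/suc k)) ⟩
  (ℕ→ℚ (suc k) * ((+ 1) / suc k)) * x
    ≡⟨ solve 3 (λ p q x → (p :* q) :* x := q :* (p :* x)) refl
        (ℕ→ℚ (suc k)) ((+ 1) / suc k) x ⟩
  ((+ 1) / suc k) * (ℕ→ℚ (suc k) * x)
    ≡⟨ cong (((+ 1) / suc k) *_) kx≡0 ⟩
  ((+ 1) / suc k) * 0ℚ
    ≡⟨ ℚ.*-zeroʳ ((+ 1) / suc k) ⟩
  0ℚ
    ∎
  where open ≡-Reasoning

x≡-x⇒x≡0 : ∀ {x} → x ≡ - x → x ≡ 0ℚ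
x≡-x⇒x≡0 {x} x≡-x = begin
  x
    ≡⟨ solve 1 (λ x → x := con ½ :* (x :+ x)) refl x ⟩
  ½ * (x + x)
    ≡⟨ cong (λ u → ½ * (x + u)) x≡-x ⟩
  ½ * (x - x)
    ≡⟨ cong (½ *_) (ℚ.+-inverseʳ x) ⟩
  ½ * 0ℚ
    ≡⟨ ℚ.*-zeroʳ ½ ⟩
  0ℚ
    ∎
  where open ≡-Reasoning

signℚ-even⊎odd : ∀ n → signℚ n ≡ 1ℚ ⊎ signℚ (suc n) ≡ 1ℚ
signℚ-even⊎odd zero    = inj₁ refl
signℚ-even⊎odd (suc n) with signℚ-even⊎odd n
... | inj₁ even = inj₂ (trans (solve 1 (λ s → :- (:- s) := s) refl (signℚ n)) even)
... | inj₂ odd  = inj₁ odd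

∑ : ℕ → (ℕ → ℚ) → ℚ
∑ zero    f = 0ℚ
∑ (suc n) f = f 0 + ∑ n (λ i → f (suc i))

sumℚ-map-applyUpTo : ∀ n (f : ℕ → ℚ) (g : ℕ → ℕ) → sumℚ (map f (applyUpTo g n)) ≡ ∑ n (λ i → f (g i))
sumℚ-map-applyUpTo zero    f g = refl
sumℚ-map-applyUpTo (suc n) f g = cong (_+_ (f (g 0))) (sumℚ-map-applyUpTo n f (λ i → g (suc i)))

sumFromTo≡∑ : ∀ lo hi f → sumFromTo lo hi f ≡ ∑ (suc hi ∸ lo) (λ i → f (lo ℕ.+ i))
sumFromTo≡∑ lo hi f = sumℚ-map-applyUpTo (suc hi ∸ lo) (λ i → f (lo ℕ.+ i)) (λ i → i)

∑-cong : ∀ n {f g : ℕ → ℚ} → (∀ i → i < n → f i ≡ g i) → ∑ n f ≡ ∑ n g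
∑-cong zero    f≡g = refl
∑-cong (suc n) f≡g = cong₂ _+_ (f≡g 0 z<s) (∑-cong n (λ i i<n → f≡g (suc i) (s<s i<n)))

∑-suc : ∀ n f → ∑ (suc n) f ≡ ∑ n f + f n
∑-suc zero    f = trans (ℚ.+-identityʳ (f 0)) (sym (ℚ.+-identityˡ (f 0)))
∑-suc (suc n) f = trans (cong (_+_ (f 0)) (∑-suc n (λ i → f (suc i)))) (sym (ℚ.+-assoc (f 0) _ _))

∑-+ : ∀ n f g → ∑ n (λ i → f i + g i) ≡ ∑ n f + ∑ n g
∑-+ zero    f g = refl
∑-+ (suc n) f g = trans (cong (_+_ (f 0 + g 0)) (∑-+ n (λ i → f (suc i)) (λ i → g (suc i))))
  (solve 4 (λ a b c d → (a :+ b) :+ (c :+ d) := (a :+ c) :+ (b :+ d)) refl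
     (f 0) (g 0) (∑ n (λ i → f (suc i))) (∑ n (λ i → g (suc i))))

∑-*ˡ : ∀ n x f → ∑ n (λ i → x * f i) ≡ x * ∑ n f
∑-*ˡ zero    x f = sym (ℚ.*-zeroʳ x)
∑-*ˡ (suc n) x f = trans (cong (_+_ (x * f 0)) (∑-*ˡ n x (λ i → f (suc i)))) (sym (ℚ.*-distribˡ-+ x (f 0) _))

module ShiftedBinomialSums (c : ℕ → ℚ) where

  S : ℕ → ℕ → ℚ
  S j m = ∑ (suc m) (λ i → ℕ→ℚ (m C i) * c (j ℕ.+ i))

  properSum : ℕ → ℚ
  properSum n = ∑ n (λ i → ℕ→ℚ (n C i) * c i)

  S-pascal : ∀ j m → S j (suc m) ≡ S (suc j) m + S j m
  S-pascal j m = begin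
    c₀ + ∑ (suc m) (λ i → ℕ→ℚ (suc m C suc i) * c (j ℕ.+ suc i))
      ≡⟨ cong (_+_ c₀) (∑-cong (suc m) (λ i _ → split i)) ⟩
    c₀ + ∑ (suc m) (λ i → ℕ→ℚ (m C i) * c (suc j ℕ.+ i) + g i)
      ≡⟨ cong (_+_ c₀) (∑-+ (suc m) (λ i → ℕ→ℚ (m C i) * c (suc j ℕ.+ i)) g) ⟩
    c₀ + (S (suc j) m + ∑ (suc m) g)
      ≡⟨ cong (λ u → c₀ + (S (suc j) m + u)) (trans (∑-suc m g) (cong (_+_ (∑ m g)) g-last)) ⟩
    c₀ + (S (suc j) m + (∑ m g + 0ℚ))
      ≡⟨ solve 3 (λ h X Y → h :+ (X :+ (Y :+ con 0ℚ)) := X :+ (h :+ Y)) refl c₀ (S (suc j) m) (∑ m g) ⟩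
    S (suc j) m + S j m
      ∎
    where
    open ≡-Reasoning
    c₀ = ℕ→ℚ 1 * c (j ℕ.+ 0)
    g : ℕ → ℚ
    g i = ℕ→ℚ (m C suc i) * c (j ℕ.+ suc i)
    g-last : g m ≡ 0ℚ
    g-last = trans (cong (λ u → ℕ→ℚ u * c (j ℕ.+ suc m)) (k>n⇒nCk≡0 (n<1+n m))) (ℚ.*-zeroˡ (c (j ℕ.+ suc m)))
    split : ∀ i → ℕ→ℚ (suc m C suc i) * c (j ℕ.+ suc i) ≡ ℕ→ℚ (m C i) * c (suc j ℕ.+ i) + g i
    split i = begin
      ℕ→ℚ (suc m C suc i) * c (j ℕ.+ suc i)
        ≡⟨ cong (λ u → ℕ→ℚ u * c (j ℕ.+ suc i)) (sym (nCk+nC[k+1]≡[n+1]C[k+1] m i)) ⟩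
      ℕ→ℚ (m C i ℕ.+ m C suc i) * c (j ℕ.+ suc i)
        ≡⟨ cong (_* c (j ℕ.+ suc i)) (ℕ→ℚ-+ (m C i) (m C suc i)) ⟩
      (ℕ→ℚ (m C i) + ℕ→ℚ (m C suc i)) * c (j ℕ.+ suc i)
        ≡⟨ ℚ.*-distribʳ-+ (c (j ℕ.+ suc i)) (ℕ→ℚ (m C i)) (ℕ→ℚ (m C suc i)) ⟩
      ℕ→ℚ (m C i) * c (j ℕ.+ suc i) + g i
        ≡⟨ cong (λ u → ℕ→ℚ (m C i) * c u + g i) (+-suc j i) ⟩
      ℕ→ℚ (m C i) * c (suc j ℕ.+ i) + g i
        ∎

  defect : ℕ → ℕ → ℚ
  defect j m = S j m - signℚ (j ℕ.+ m) * S m j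

  defect-pascal : ∀ j m → defect j (suc m) ≡ defect (suc j) m + defect j m
  defect-pascal j m = begin
    S j (suc m) - signℚ (j ℕ.+ suc m) * S (suc m) j
      ≡⟨ cong₂ (λ u v → u - signℚ v * S (suc m) j) (S-pascal j m) (+-suc j m) ⟩
    (S (suc j) m + S j m) - (- σ) * S (suc m) j
      ≡⟨ solve 5 (λ A B s D E → (A :+ B) :- (:- s) :* D := (A :- (:- s) :* (D :+ E)) :+ (B :- s :* E)) refl
           (S (suc j) m) (S j m) σ (S (suc m) j) (S m j) ⟩
    (S (suc j) m - (- σ) * (S (suc m) j + S m j)) + (S j m - σ * S m j)
      ≡⟨ cong (λ u → (S (suc j) m - (- σ) * u) + defect j m) (sym (S-pascal m j)) ⟩
    defect (suc j) m + defect j m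
      ∎
    where
    open ≡-Reasoning
    σ = signℚ (j ℕ.+ m)

  defect-top : ∀ n → defect n 0 ≡ c n - signℚ n * (properSum n + c n)
  defect-top n = trans (cong₂ (λ x y → x - signℚ (n ℕ.+ 0) * y) S-n-0 S-0-n)
                       (cong (λ k → c n - signℚ k * (properSum n + c n)) (+-identityʳ n))
    where
    S-n-0 : S n 0 ≡ c n
    S-n-0 = trans (ℚ.+-identityʳ _) (trans (ℚ.*-identityˡ _) (cong c (+-identityʳ n)))
    S-0-n : S 0 n ≡ properSum n + c n
    S-0-n = trans (∑-suc n _)
              (cong (_+_ (properSum n)) (trans (cong (λ k → ℕ→ℚ k * c n) (nCn≡1 n)) (ℚ.*-identityˡ (c n))))

  defect-swap : ∀ n → signℚ n ≡ 1ℚ → defect 0 n ≡ - defect n 0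
  defect-swap n even = begin
    S 0 n - signℚ n * S n 0
      ≡⟨ cong (λ u → S 0 n - u * S n 0) even ⟩
    S 0 n - 1ℚ * S n 0
      ≡⟨ solve 2 (λ a b → a :- con 1ℚ :* b := :- (b :- con 1ℚ :* a)) refl (S 0 n) (S n 0) ⟩
    - (S n 0 - 1ℚ * S 0 n)
      ≡⟨ cong (λ u → - (S n 0 - u * S 0 n)) (sym (trans (cong signℚ (+-identityʳ n)) even)) ⟩
    - defect n 0
      ∎
    where open ≡-Reasoning

  SymmetricLevel : ℕ → Set
  SymmetricLevel n = ∀ j m → j ℕ.+ m ≡ n → defect j m ≡ 0ℚ

  defect-constant-on-next-level : ∀ n → SymmetricLevel n →
    ∀ j m → j ℕ.+ m ≡ suc n → defect j m ≡ defect (suc n) 0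
  defect-constant-on-next-level n sym-n j zero    j+0≡1+n =
    cong (λ x → defect x 0) (trans (sym (+-identityʳ j)) j+0≡1+n)
  defect-constant-on-next-level n sym-n j (suc m) j+1+m≡1+n = begin
    defect j (suc m)
      ≡⟨ defect-pascal j m ⟩
    defect (suc j) m + defect j m
      ≡⟨ cong (_+_ (defect (suc j) m)) (sym-n j m (suc-injective 1+j+m≡1+n)) ⟩
    defect (suc j) m + 0ℚ
      ≡⟨ ℚ.+-identityʳ _ ⟩
    defect (suc j) m
      ≡⟨ defect-constant-on-next-level n sym-n (suc j) m 1+j+m≡1+n ⟩
    defect (suc n) 0
      ∎
    where
    open ≡-Reasoning
    1+j+m≡1+n : suc j ℕ.+ m ≡ suc n
    1+j+m≡1+n = trans (sym (+-suc j m)) j+1+m≡1+n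

  module _ (odd-step : ∀ n → signℚ n ≡ 1ℚ → defect n 0 ≡ 0ℚ → defect (suc n) 0 ≡ 0ℚ) where

    symmetricLevel : ∀ n → SymmetricLevel n
    symmetricLevel zero    zero zero refl = solve 1 (λ x → x :- con 1ℚ :* x := con 0ℚ) refl (S 0 0)
    symmetricLevel (suc n) j m j+m≡1+n =
      trans (defect-constant-on-next-level n (symmetricLevel n) j m j+m≡1+n) top
      where
      top : defect (suc n) 0 ≡ 0ℚ
      top with signℚ-even⊎odd n
      ... | inj₁ even = odd-step n even (symmetricLevel n n 0 (+-identityʳ n))
      ... | inj₂ odd  = x≡-x⇒x≡0
        (trans (sym (defect-constant-on-next-level n (symmetricLevel n) 0 (suc n) refl)) (defect-swap (suc n) odd))

    S-symmetric : ∀ j m → S j m ≡ signℚ (j ℕ.+ m) * S m j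
    S-symmetric j m = begin
      S j m
        ≡⟨ solve 3 (λ a s b → a := (a :- s :* b) :+ s :* b) refl (S j m) σ (S m j) ⟩
      defect j m + σ * S m j
        ≡⟨ cong (_+ σ * S m j) (symmetricLevel (j ℕ.+ m) j m refl) ⟩
      0ℚ + σ * S m j
        ≡⟨ ℚ.+-identityˡ _ ⟩
      σ * S m j
        ∎
      where
      open ≡-Reasoning
      σ = signℚ (j ℕ.+ m)

module _ (a : ℤ) where

  bG-unfold : ∀ n → bG a n ≡ next a n (approx a n)
  bG-unfold n = cong (λ t → if t then approx a n n else next a n (approx a n)) (n<ᵇn≡false n)

  approx-suc : ∀ {m k} → k < m → approx a (suc m) k ≡ approx a m k
  approx-suc {m} {k} k<m with k <ᵇ m | <⇒<ᵇ k<m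
  ... | true | _ = refl

  approx-correct : ∀ {m k} → k < m → approx a m k ≡ bG a k
  approx-correct {suc m} k<1+m with m<1+n⇒m<n∨m≡n k<1+m
  ... | inj₁ k<m  = trans (approx-suc k<m) (approx-correct k<m)
  ... | inj₂ refl = refl

  c : ℕ → ℚ
  c k = ((+ 1) / suc k) * bG a k

  open ShiftedBinomialSums c

  bG≡[1+k]*c : ∀ k → bG a k ≡ ℕ→ℚ (suc k) * c k
  bG≡[1+k]*c k = begin
    bG a k
      ≡⟨ sym (ℚ.*-identityˡ (bG a k)) ⟩
    1ℚ * bG a k
      ≡⟨ cong (_* bG a k) (sym (ℕ→ℚ-suc*1/suc k)) ⟩
    (ℕ→ℚ (suc k) * ((+ 1) / suc k)) * bG a k
      ≡⟨ ℚ.*-assoc (ℕ→ℚ (suc k)) ((+ 1) / suc k) (bG a k) ⟩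
    ℕ→ℚ (suc k) * c k
      ∎
    where open ≡-Reasoning

  bG*[1+n]C[1+k] : ∀ n k → bG a k * ℕ→ℚ (suc n C suc k) ≡ ℕ→ℚ (suc n) * (ℕ→ℚ (n C k) * c k)
  bG*[1+n]C[1+k] n k = begin
    bG a k * ℕ→ℚ (suc n C suc k)
      ≡⟨ cong (_* ℕ→ℚ (suc n C suc k)) (bG≡[1+k]*c k) ⟩
    (ℕ→ℚ (suc k) * c k) * ℕ→ℚ (suc n C suc k)
      ≡⟨ solve 3 (λ p q r → (p :* q) :* r := (p :* r) :* q) refl
          (ℕ→ℚ (suc k)) (c k) (ℕ→ℚ (suc n C suc k)) ⟩
    (ℕ→ℚ (suc k) * ℕ→ℚ (suc n C suc k)) * c k
      ≡⟨ cong (_* c k) (sym (ℕ→ℚ-* (suc k) (suc n C suc k))) ⟩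
    ℕ→ℚ (suc k ℕ.* (suc n C suc k)) * c k
      ≡⟨ cong (λ u → ℕ→ℚ u * c k) ([1+k]*[1+n]C[1+k]≡[1+n]*nCk n k) ⟩
    ℕ→ℚ (suc n ℕ.* (n C k)) * c k
      ≡⟨ cong (_* c k) (ℕ→ℚ-* (suc n) (n C k)) ⟩
    (ℕ→ℚ (suc n) * ℕ→ℚ (n C k)) * c k
      ≡⟨ ℚ.*-assoc (ℕ→ℚ (suc n)) (ℕ→ℚ (n C k)) (c k) ⟩
    ℕ→ℚ (suc n) * (ℕ→ℚ (n C k) * c k)
      ∎
    where open ≡-Reasoning

  approx-weighted-sum : ∀ {m} n → n ≤ m →
    ∑ n (λ k → approx a m k * ℕ→ℚ (suc n C suc k)) ≡ ℕ→ℚ (suc n) * properSum n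
  approx-weighted-sum n n≤m =
    trans (∑-cong n (λ k k<n → trans (cong (_* ℕ→ℚ (suc n C suc k)) (approx-correct (<-≤-trans k<n n≤m)))
                                     (bG*[1+n]C[1+k] n k)))
          (∑-*ˡ n (ℕ→ℚ (suc n)) (λ i → ℕ→ℚ (n C i) * c i))

  c-recurrence : ∀ n → let N = 3 ℕ.+ n in
    ℕ→ℚ (suc N) * c N ≡ - (½ * (ℕ→ℚ N * properSum (N ∸ 1) + ℕ→ℚ (suc N) * properSum N))
  c-recurrence n = begin
    ℕ→ℚ (suc N) * c N
      ≡⟨ sym (bG≡[1+k]*c N) ⟩
    bG a N
      ≡⟨ bG-unfold N ⟩
    - (½ * (sumFromTo 0 (N ∸ 2) lower + sumFromTo 0 (N ∸ 1) upper))
      ≡⟨ cong (λ u → - (½ * u)) (cong₂ _+_ (sumFromTo≡∑ 0 (N ∸ 2) lower) (sumFromTo≡∑ 0 (N ∸ 1) upper)) ⟩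
    - (½ * (∑ (N ∸ 1) lower + ∑ N upper))
      ≡⟨ cong (λ u → - (½ * u)) (cong₂ _+_ (approx-weighted-sum (N ∸ 1) (n≤1+n _)) (approx-weighted-sum N ≤-refl)) ⟩
    - (½ * (ℕ→ℚ N * properSum (N ∸ 1) + ℕ→ℚ (suc N) * properSum N))
      ∎
    where
    open ≡-Reasoning
    N = 3 ℕ.+ n
    lower upper : ℕ → ℚ
    lower k = approx a N k * ℕ→ℚ (N C suc k)
    upper k = approx a N k * ℕ→ℚ (suc N C suc k)

  defect-odd-step : ∀ N → signℚ N ≡ 1ℚ → defect N 0 ≡ 0ℚ → defect (suc N) 0 ≡ 0ℚ
  -- D(1,0) = b_G(1) + b_G(0) = 0; the recurrence only starts at b_G(3).
  defect-odd-step zero          _    _       = refl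
  defect-odd-step (suc (suc m)) even defect≡0 = begin
    defect n 0
      ≡⟨ defect-top n ⟩
    c n - signℚ n * (B + c n)
      ≡⟨ cong (λ s → c n - (- s) * (B + c n)) even ⟩
    c n - (- 1ℚ) * (B + c n)
      ≡⟨ solve 2 (λ x y → x :- (:- con 1ℚ) :* (y :+ x) := x :+ y :+ x) refl (c n) B ⟩
    c n + B + c n
      ≡⟨ ℕ→ℚ-suc*x≡0⇒x≡0 n _ [1+n]*[c+B+c]≡0 ⟩
    0ℚ
      ∎
    where
    open ≡-Reasoning
    N = 2 ℕ.+ m
    n = suc N
    A = properSum N
    B = properSum n
    p = ℕ→ℚ n
    q = ℕ→ℚ (suc n)
    A≡0 : A ≡ 0ℚ
    A≡0 = begin
      A
        ≡⟨ solve 2 (λ x y → x := :- (y :- con 1ℚ :* (x :+ y))) refl A (c N) ⟩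
      - (c N - 1ℚ * (A + c N))
        ≡⟨ cong (λ s → - (c N - s * (A + c N))) (sym even) ⟩
      - (c N - signℚ N * (A + c N))
        ≡⟨ cong -_ (trans (sym (defect-top N)) defect≡0) ⟩
      0ℚ
        ∎
    q*c≡-½*q*B : q * c n ≡ - (½ * (q * B))
    q*c≡-½*q*B = begin
      q * c n
        ≡⟨ c-recurrence m ⟩
      - (½ * (p * A + q * B))
        ≡⟨ cong (λ x → - (½ * (p * x + q * B))) A≡0 ⟩
      - (½ * (p * 0ℚ + q * B))
        ≡⟨ solve 2 (λ p y → :- (con ½ :* (p :* con 0ℚ :+ y)) := :- (con ½ :* y))
            refl p (q * B) ⟩
      - (½ * (q * B))
        ∎
    [1+n]*[c+B+c]≡0 : q * (c n + B + c n) ≡ 0ℚ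
    [1+n]*[c+B+c]≡0 = begin
      q * (c n + B + c n)
        ≡⟨ solve 3 (λ q x y → q :* (x :+ y :+ x) := (q :* x :+ q :* x) :+ q :* y) refl q (c n) B ⟩
      (q * c n + q * c n) + q * B
        ≡⟨ cong (λ u → (u + u) + q * B) q*c≡-½*q*B ⟩
      (- (½ * (q * B)) + - (½ * (q * B))) + q * B
        ≡⟨ solve 1 (λ y → (:- (con ½ :* y) :+ :- (con ½ :* y)) :+ y := con 0ℚ) refl (q * B) ⟩
      0ℚ
        ∎

  sG≡S : ∀ j m → sG a j (j ℕ.+ m) ≡ S j m
  sG≡S j m = trans (sumFromTo≡∑ j (j ℕ.+ m) term)
               (trans (cong (λ t → ∑ t (λ i → term (j ℕ.+ i))) length)
                      (∑-cong (suc m) (λ i i≤m → termᵢ i (≤-pred i≤m))))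
    where
    term : ℕ → ℚ
    term k = ((+ 1) / suc k) * ℕ→ℚ ((j ℕ.+ m ∸ j) C (j ℕ.+ m ∸ k)) * bG a k
    length : suc (j ℕ.+ m) ∸ j ≡ suc m
    length = trans (cong (_∸ j) (sym (+-suc j m))) (m+n∸m≡n j (suc m))
    termᵢ : ∀ i → i ≤ m → term (j ℕ.+ i) ≡ ℕ→ℚ (m C i) * c (j ℕ.+ i)
    termᵢ i i≤m = trans
      (cong (λ u → ((+ 1) / suc (j ℕ.+ i)) * ℕ→ℚ u * bG a (j ℕ.+ i))
            (trans (cong₂ _C_ (m+n∸m≡n j m) ([m+n]∸[m+o]≡n∸o j m i)) (sym (nCk≡nC[n∸k] i≤m))))
      (solve 3 (λ x y z → x :* y :* z := y :* (x :* z)) refl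
             ((+ 1) / suc (j ℕ.+ i)) (ℕ→ℚ (m C i)) (bG a (j ℕ.+ i)))

  sG-symmetric : ∀ j m → sG a j (j ℕ.+ m) ≡ signℚ (j ℕ.+ m) * sG a m (j ℕ.+ m)
  sG-symmetric j m = begin
    sG a j (j ℕ.+ m)
      ≡⟨ sG≡S j m ⟩
    S j m
      ≡⟨ S-symmetric defect-odd-step j m ⟩
    signℚ (j ℕ.+ m) * S m j
      ≡⟨ cong (signℚ (j ℕ.+ m) *_) (sym (sG≡S m j)) ⟩
    signℚ (j ℕ.+ m) * sG a m (m ℕ.+ j)
      ≡⟨ cong (λ d → signℚ (j ℕ.+ m) * sG a m d) (+-comm m j) ⟩
    signℚ (j ℕ.+ m) * sG a m (j ℕ.+ m)
      ∎
    where open ≡-Reasoning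

mainTheorem15 : (a : ℤ) → a ≤ℤ -[1+ 0 ] → (d j : ℕ) → j ≤ d →
    sG a j d ≡ signℚ d * sG a (d ∸ j) d
mainTheorem15 a _ d j j≤d =
  subst (λ e → sG a j e ≡ signℚ e * sG a (d ∸ j) e) (m+[n∸m]≡n j≤d) (sG-symmetric a j (d ∸ j))
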